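{- Let $\zeta=e^{2i\pi/3}$ and $\bar\zeta=e^{ -2i\pi/3}$, and let $F(x)\in\mathbb C[x]((t))$. Then \[ [x^{\ge}]\frac{F(\bar x)}{1+x+x^2}=\frac1{1-\zeta}\frac{F(\zeta)}{1-\zeta x}+\frac1{1-\bar\zeta}\frac{F(\bar\zeta)}{1-\bar\zeta x} \] and \begin{multline*} [x^{\ge}]\frac{F(\bar x)}{(1+x+x^2)^2}=\frac23\left(\frac1{1-\zeta}\frac{F(\zeta)}{1-\zeta x}+\frac1{1-\bar\zeta}\frac{F(\bar\zeta)}{1-\bar\zeta x}\right)\\ +\frac1{(1-\zeta)^2}\left(\frac{\zeta F'(\zeta)}{1-\zeta x}+\frac{F(\zeta)}{(1-\zeta x)^2}\right)+\frac1{(1-\bar\zeta)^2}\left(\frac{\bar\zeta F'(\bar\zeta)}{1-\bar\zeta x}+\frac{F(\bar\zeta)}{(1-\bar\zeta x)^2}\right). \end{multline*} Moreover, the first identity holds for $F(x)\in\bar x\,\mathbb C[x]((t))$, and the second for $F(x)\in\bar x^3\,\mathbb C[x]((t))$.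
   Context: $\bar x=1/x$. Rational functions of $x$ are expanded as Laurent series around $x=0$, so that the expressions above are viewed in $\mathbb C((x))((t))$. For $G(x;t)=\sum_{n\ge n_0}t^n\sum_{i\ge i_0(n)}a(n,i)x^i$, the non-negative part is $[x^{\ge}]G=\sum_{n\ge n_0}t^n\sum_{i\ge\max(0,i_0(n))}a(n,i)x^i$. $F(\zeta)$, $F'(\zeta)$ denote evaluation of $F$ and of its derivative with respect to $x$ at $x=\zeta$, coefficientwise in $t$. -}

module Defs where

open import Level using (Level)
open import Algebra.Bundles using (CommutativeRing)
open import Data.Nat using (ℕ; zero; suc; _∸_; _≤?_) renaming (_+_ to _+ℕ_; _<_ to _<ℕ_)
open import Data.List using (List; []; _∷_)
open import Data.Product using (_×_)
open import Relation.Nullary using (yes; no)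
import Data.Integer

-- Everything is developed over an arbitrary commutative ring R (the paper uses ℂ).
module _ {c ℓ : Level} (R : CommutativeRing c ℓ) where
  open CommutativeRing R

  nat : ℕ → Carrier
  nat zero = 0#
  nat (suc n) = 1# + nat n

  pow : Carrier → ℕ → Carrier
  pow z zero = 1#
  pow z (suc n) = z * pow z n

  coefAt : List Carrier → ℕ → Carrier
  coefAt [] _ = 0#
  coefAt (a ∷ as) zero = a
  coefAt (a ∷ as) (suc j) = coefAt as j

  -- Laurent polynomial  Σ_j cs_j x^(j - low)
  record LPoly : Set c where
    constructor lpoly
    field
      low : ℕ
      cs  : List Carrier
  open LPoly public

  -- p ∈ x̄^d ℂ[x] : all coefficients of exponent < -d vanish
  InXbarPow : ℕ → LPoly → Set ℓ
  InXbarPow d p = ∀ j → j +ℕ d <ℕ low p → coefAt (cs p) j ≈ 0#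

  -- evaluation at z, where zinv is the inverse of z
  evalL : Carrier → Carrier → LPoly → Carrier
  evalL z zinv p = go 0 (cs p) * pow zinv (low p)
    where
    go : ℕ → List Carrier → Carrier
    go j [] = 0#
    go j (a ∷ as) = a * pow z j + go (suc j) as

  -- derivative with respect to x:  d/dx x^(j-low) = (j - low) x^(j-(low+1))
  derivL : LPoly → LPoly
  derivL p = lpoly (suc (low p)) (go 0 (cs p))
    where
    go : ℕ → List Carrier → List Carrier
    go j [] = []
    go j (a ∷ as) = (nat j * a - nat (low p) * a) ∷ go (suc j) as

  Series : Set c
  Series = ℕ → Carrier

  _+s_ : Series → Series → Series
  (S +s T) n = S n + T n

  _·s_ : Carrier → Series → Series
  (a ·s S) n = a * S n

  sumTo : ℕ → (ℕ → Carrier) → Carrier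
  sumTo zero f = f 0
  sumTo (suc n) f = sumTo n f + f (suc n)

  _⋆_ : Series → Series → Series
  (S ⋆ T) n = sumTo n (λ k → S k * T (n ∸ k))

  -- 1/(1 - z x) = Σ z^m x^m
  geom : Carrier → Series
  geom z m = pow z m

  -- 1/(1 + x + x²) : the unique series g with (1+x+x²) g = 1
  invQ : Series
  invQ zero = 1#
  invQ (suc zero) = - 1#
  invQ (suc (suc m)) = - (invQ (suc m) + invQ m)

  invQ2 : Series
  invQ2 = invQ ⋆ invQ

  -- coefficient of x^i (i ≥ 0) in p(x̄) · S(x)   (p(x̄) = Σ_j cs_j x^(low - j))
  nonnegCoef : LPoly → Series → ℕ → Carrier
  nonnegCoef p S i = go 0 (cs p)
    where
    go : ℕ → List Carrier → Carrier
    go j [] = 0#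
    go j (a ∷ as) with low p ≤? j +ℕ i
    ... | yes _ = a * S ((j +ℕ i) ∸ low p) + go (suc j) as
    ... | no _  = 0# + go (suc j) as

  -- Laurent series in t with coefficients Laurent polynomials in x:
  -- F = Σ_{k ≥ 0} t^(ord + k) · coef k
  record TSeries : Set c where
    field
      ord  : Data.Integer.ℤ
      coef : ℕ → LPoly
  open TSeries public

  TInXbarPow : ℕ → TSeries → Set ℓ
  TInXbarPow d F = ∀ k → InXbarPow d (coef F k)

  module Identities (ζ ζb a b twoThirds : Carrier) where
    -- with a = 1/(1-ζ), b = 1/(1-ζ̄), twoThirds = 2/3
    rhs1 : LPoly → Series
    rhs1 p = ((a * evalL ζ ζb p) ·s geom ζ) +s ((b * evalL ζb ζ p) ·s geom ζb)

    rhs2 : LPoly → Series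
    rhs2 p = (twoThirds ·s rhs1 p)
          +s (((a * a) ·s (((ζ * evalL ζ ζb (derivL p)) ·s geom ζ) +s (evalL ζ ζb p ·s (geom ζ ⋆ geom ζ))))
          +s ((b * b) ·s (((ζb * evalL ζb ζ (derivL p)) ·s geom ζb) +s (evalL ζb ζ p ·s (geom ζb ⋆ geom ζb)))))

    Identity1 : ℕ → Set (c Level.⊔ ℓ)
    Identity1 d = (F : TSeries) → TInXbarPow d F →
      ∀ k i → nonnegCoef (coef F k) invQ i ≈ rhs1 (coef F k) i

    Identity2 : ℕ → Set (c Level.⊔ ℓ)
    Identity2 d = (F : TSeries) → TInXbarPow d F →
      ∀ k i → nonnegCoef (coef F k) invQ2 i ≈ rhs2 (coef F k) i

-- Both sides are linear in F, so it suffices to compare, for each monomial x^e of F(x) (coefficient j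
-- of an LPoly with low L, e = j - L), the coefficient of x^i. With m = i + e, the left-hand side gives
-- [x^m] 1/(1+x+x²) (resp. 1/(1+x+x²)²) when m ≥ 0 and 0 otherwise, while the right-hand side gives,
-- for every m ∈ ℤ,
--   U(m) = a ζ^m + b ζ̄^m,   resp.   V(m) = (2/3) U(m) + (m+1) (a² ζ^m + b² ζ̄^m).
-- Both U and V satisfy the recurrences s(m+2) + s(m+1) + s(m) = 0, resp. = U(m+2), that characterise the
-- coefficients of 1/(1+x+x²) and of its square from their first two values. Running them backwards
-- gives U(-1) = 0 and V(-1) = V(-2) = V(-3) = 0, which is what the terms with m < 0 require when
-- F ∈ x̄ ℂ[x]((t)), resp. F ∈ x̄³ ℂ[x]((t)).
module Submission where

open import Level using (Level)
open import Algebra.Bundles using (CommutativeRing; RawRing)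
open import Algebra.Solver.Ring.AlmostCommutativeRing using (_-Raw-AlmostCommutative⟶_; fromCommutativeRing)
open import Data.Bool using (if_then_else_)
open import Data.Integer as ℤ using (ℤ; +_; -[1+_]; _⊖_)
import Data.Integer.Properties as ℤP
open import Data.List using (List; []; _∷_)
open import Data.Maybe using (Maybe; just; nothing)
open import Data.Nat using (ℕ; zero; suc; _∸_; _≤_; _<_; _≤?_; _<?_; z≤n; s≤s)
  renaming (_+_ to _+ℕ_; _*_ to _*ℕ_)
import Data.Nat.Properties as ℕP
open import Data.Product using (_×_; _,_; proj₁; proj₂)
open import Relation.Binary.PropositionalEquality as ≡ using (_≡_)
open import Relation.Nullary using (Dec; yes; no; does; ¬_)
open import Relation.Nullary.Decidable using (dec-true; dec-false)
open import Defs

module NatCast {c ℓ : Level} (R : CommutativeRing c ℓ) where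
  open CommutativeRing R
  open import Relation.Binary.Reasoning.Setoid setoid

  nat-+ : ∀ m n → nat R (m +ℕ n) ≈ nat R m + nat R n
  nat-+ zero n = sym (+-identityˡ _)
  nat-+ (suc m) n = trans (+-congˡ (nat-+ m n)) (sym (+-assoc _ _ _))

  nat-* : ∀ m n → nat R (m *ℕ n) ≈ nat R m * nat R n
  nat-* zero n = sym (zeroˡ _)
  nat-* (suc m) n = begin
    nat R (n +ℕ m *ℕ n)              ≈⟨ nat-+ n (m *ℕ n) ⟩
    nat R n + nat R (m *ℕ n)         ≈⟨ +-cong (*-identityˡ _) (sym (nat-* m n)) ⟨
    1# * nat R n + nat R m * nat R n ≈⟨ distribʳ _ _ _ ⟨
    (1# + nat R m) * nat R n         ∎

-- Algebra.Solver.Ring with integer coefficients, the pair (m , n) standing for m - n.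
module IntegerCoefficients {c ℓ : Level} (R : CommutativeRing c ℓ) where
  open CommutativeRing R
  open NatCast R
  open import Algebra.Properties.Ring ring using (-0#≈0#; -‿+-comm; ⁻¹-anti-homo‿-; x[y-z]≈xy-xz; [y-z]x≈yx-zx)
  open import Algebra.Properties.CommutativeSemigroup +-commutativeSemigroup using (interchange)
  open import Relation.Binary.Reasoning.Setoid setoid

  private
    -+-interchange : ∀ w x y z → (w - x) + (y - z) ≈ (w + y) - (x + z)
    -+-interchange w x y z = trans (interchange w (- x) y (- z)) (+-congˡ (-‿+-comm x z))

    -*-expand : ∀ w x y z → (w - x) * (y - z) ≈ (w * y + x * z) - (w * z + x * y)
    -*-expand w x y z = begin
      (w - x) * (y - z)                 ≈⟨ x[y-z]≈xy-xz _ _ _ ⟩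
      (w - x) * y - (w - x) * z         ≈⟨ +-cong ([y-z]x≈yx-zx _ _ _) (-‿cong ([y-z]x≈yx-zx _ _ _)) ⟩
      (w * y - x * y) - (w * z - x * z) ≈⟨ +-congˡ (⁻¹-anti-homo‿- _ _) ⟩
      (w * y - x * y) + (x * z - w * z) ≈⟨ -+-interchange _ _ _ _ ⟩
      (w * y + x * z) - (x * y + w * z) ≈⟨ +-congˡ (-‿cong (+-comm _ _)) ⟩
      (w * y + x * z) - (w * z + x * y) ∎

    1+-cancel : ∀ x y → (1# + x) - (1# + y) ≈ x - y
    1+-cancel x y = begin
      (1# + x) - (1# + y) ≈⟨ -+-interchange 1# 1# x y ⟨
      (1# - 1#) + (x - y) ≈⟨ +-congʳ (-‿inverseʳ 1#) ⟩
      0# + (x - y)        ≈⟨ +-identityˡ _ ⟩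
      x - y               ∎

    -- unlike nat, ℕ→R 1 is the literal 1#, so that evaluated constants match goals written with 1#
    ℕ→R : ℕ → Carrier
    ℕ→R 0 = 0#
    ℕ→R 1 = 1#
    ℕ→R (suc (suc n)) = 1# + ℕ→R (suc n)

    ℕ→R≈nat : ∀ n → ℕ→R n ≈ nat R n
    ℕ→R≈nat 0 = refl
    ℕ→R≈nat 1 = sym (+-identityʳ 1#)
    ℕ→R≈nat (suc (suc n)) = +-congˡ (ℕ→R≈nat (suc n))

    ⟦_⟧ : ℕ × ℕ → Carrier
    ⟦ m , zero ⟧ = ℕ→R m
    ⟦ zero , suc n ⟧ = - ℕ→R (suc n)
    ⟦ suc m , suc n ⟧ = ⟦ m , n ⟧

    ⟦⟧-difference : ∀ m n → ⟦ m , n ⟧ ≈ nat R m - nat R n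
    ⟦⟧-difference m zero = trans (ℕ→R≈nat m) (sym (trans (+-congˡ -0#≈0#) (+-identityʳ _)))
    ⟦⟧-difference zero (suc n) = trans (-‿cong (ℕ→R≈nat (suc n))) (sym (+-identityˡ _))
    ⟦⟧-difference (suc m) (suc n) = trans (⟦⟧-difference m n) (sym (1+-cancel _ _))

    normalise : ℕ × ℕ → ℕ × ℕ
    normalise (m , n) = m ∸ n , n ∸ m

    ⟦normalise⟧ : ∀ m n → ⟦ normalise (m , n) ⟧ ≈ nat R m - nat R n
    ⟦normalise⟧ m n = trans (⟦⟧-difference (m ∸ n) (n ∸ m)) (truncated m n)
      where
      truncated : ∀ m n → nat R (m ∸ n) - nat R (n ∸ m) ≈ nat R m - nat R n
      truncated zero zero = refl
      truncated zero (suc n) = refl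
      truncated (suc m) zero = refl
      truncated (suc m) (suc n) = trans (truncated m n) (sym (1+-cancel _ _))

    ℤ-pairs : RawRing _ _
    ℤ-pairs = record
      { Carrier = ℕ × ℕ ; _≈_ = _≡_
      ; _+_ = λ { (m , n) (m′ , n′) → normalise (m +ℕ m′ , n +ℕ n′) }
      ; _*_ = λ { (m , n) (m′ , n′) → normalise (m *ℕ m′ +ℕ n *ℕ n′ , m *ℕ n′ +ℕ n *ℕ m′) }
      ; -_ = λ { (m , n) → n , m }
      ; 0# = 0 , 0 ; 1# = 1 , 0
      }

    morphism : ℤ-pairs -Raw-AlmostCommutative⟶ fromCommutativeRing R
    morphism = record
      { ⟦_⟧ = ⟦_⟧
      ; +-homo = λ { (m , n) (m′ , n′) → begin
          ⟦ normalise (m +ℕ m′ , n +ℕ n′) ⟧           ≈⟨ ⟦normalise⟧ (m +ℕ m′) (n +ℕ n′) ⟩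
          nat R (m +ℕ m′) - nat R (n +ℕ n′)           ≈⟨ +-cong (nat-+ m m′) (-‿cong (nat-+ n n′)) ⟩
          (nat R m + nat R m′) - (nat R n + nat R n′) ≈⟨ -+-interchange _ _ _ _ ⟨
          (nat R m - nat R n) + (nat R m′ - nat R n′)
            ≈⟨ +-cong (⟦⟧-difference m n) (⟦⟧-difference m′ n′) ⟨
          ⟦ m , n ⟧ + ⟦ m′ , n′ ⟧                     ∎ }
      ; *-homo = λ { (m , n) (m′ , n′) → begin
          ⟦ normalise (m *ℕ m′ +ℕ n *ℕ n′ , m *ℕ n′ +ℕ n *ℕ m′) ⟧
            ≈⟨ ⟦normalise⟧ (m *ℕ m′ +ℕ n *ℕ n′) (m *ℕ n′ +ℕ n *ℕ m′) ⟩
          nat R (m *ℕ m′ +ℕ n *ℕ n′) - nat R (m *ℕ n′ +ℕ n *ℕ m′)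
            ≈⟨ +-cong (trans (nat-+ (m *ℕ m′) (n *ℕ n′)) (+-cong (nat-* m m′) (nat-* n n′)))
                      (-‿cong (trans (nat-+ (m *ℕ n′) (n *ℕ m′)) (+-cong (nat-* m n′) (nat-* n m′)))) ⟩
          (nat R m * nat R m′ + nat R n * nat R n′) - (nat R m * nat R n′ + nat R n * nat R m′)
            ≈⟨ -*-expand _ _ _ _ ⟨
          (nat R m - nat R n) * (nat R m′ - nat R n′)
            ≈⟨ *-cong (⟦⟧-difference m n) (⟦⟧-difference m′ n′) ⟨
          ⟦ m , n ⟧ * ⟦ m′ , n′ ⟧ ∎ }
      ; -‿homo = λ { (m , n) → begin
          ⟦ n , m ⟧             ≈⟨ ⟦⟧-difference n m ⟩
          nat R n - nat R m     ≈⟨ ⁻¹-anti-homo‿- _ _ ⟨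
          - (nat R m - nat R n) ≈⟨ -‿cong (⟦⟧-difference m n) ⟨
          - ⟦ m , n ⟧           ∎ }
      ; 0-homo = refl
      ; 1-homo = refl
      }

    ⟦⟧-equal? : ∀ x y → Maybe (⟦ x ⟧ ≈ ⟦ y ⟧)
    ⟦⟧-equal? (m , n) (m′ , n′) with m ℕP.≟ m′ | n ℕP.≟ n′
    ... | yes ≡.refl | yes ≡.refl = just refl
    ... | _          | _          = nothing

  open import Algebra.Solver.Ring ℤ-pairs (fromCommutativeRing R) morphism ⟦⟧-equal? public
    using (Polynomial; solve; _:=_; _:+_; _:*_; _:-_; :-_; con)

  κ : ∀ {n} → ℕ → Polynomial n
  κ k = con (k , 0)

module LaurentExpansion {c ℓ : Level} (R : CommutativeRing c ℓ) where
  open CommutativeRing R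
  open NatCast R
  open import Algebra.Properties.Ring ring using (-0#≈0#; +-cancelʳ; +-identityʳ-unique)
  open import Algebra.Properties.CommutativeSemigroup *-commutativeSemigroup using (x∙yz≈y∙xz)
  open import Algebra.Properties.CommutativeSemigroup +-commutativeSemigroup using (interchange)
  open import Relation.Binary.Reasoning.Setoid setoid
  open IntegerCoefficients R

  modulo : ∀ {x y e} k → e ≈ 0# → x ≈ y + k * e → x ≈ y
  modulo {y = y} k e≈0 x≈ = trans x≈ (trans (+-congˡ (trans (*-congˡ e≈0) (zeroʳ k))) (+-identityʳ y))

  x≈y⇒x-y≈0 : ∀ {x y} → x ≈ y → x - y ≈ 0#
  x≈y⇒x-y≈0 {y = y} x≈y = trans (+-congʳ x≈y) (-‿inverseʳ y)

  last-term-vanishes : ∀ {x y w e} → x + (y + w) ≈ e → x + y ≈ e → w ≈ 0#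
  last-term-vanishes {x} {y} {w} rec sum =
    +-identityʳ-unique (x + y) w (trans (+-assoc x y w) (trans rec (sym sum)))

  pow-+ : ∀ u m n → pow R u (m +ℕ n) ≈ pow R u m * pow R u n
  pow-+ u zero n = sym (*-identityˡ _)
  pow-+ u (suc m) n = trans (*-congˡ (pow-+ u m n)) (sym (*-assoc _ _ _))

  root-cube : ∀ {ζ} → ζ * ζ + ζ + 1# ≈ 0# → ζ * (ζ * ζ) ≈ 1#
  root-cube {ζ} root = modulo (ζ - 1#) root
    (solve 1 (λ ζ → ζ :* (ζ :* ζ) := κ 1 :+ (ζ :- κ 1) :* (ζ :* ζ :+ ζ :+ κ 1)) refl ζ)

  root-conjugate-sum : ∀ {ζ} → ζ * ζ + ζ + 1# ≈ 0# → ζ + ζ * ζ + 1# ≈ 0#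
  root-conjugate-sum root = trans (+-congʳ (+-comm _ _)) root

  module Root {u c : Carrier} (root : u * u + u + 1# ≈ 0#) (inverse : (1# - u) * c ≈ 1#) where
    *-root : c * u ≈ c - 1#
    *-root = begin
      c * u               ≈⟨ solve 2 (λ u c → c :* u := c :- (κ 1 :- u) :* c) refl u c ⟩
      c - (1# - u) * c    ≈⟨ +-congˡ (-‿cong inverse) ⟩
      c - 1#              ∎

    *-twice-root+1 : c * (u + u + 1#) ≈ u
    *-twice-root+1 = begin
      c * (u + u + 1#)
        ≈⟨ solve 2 (λ u c → c :* (u :+ u :+ κ 1) := u :* ((κ 1 :- u) :* c) :+ c :* (u :* u :+ u :+ κ 1))
             refl u c ⟩
      u * ((1# - u) * c) + c * (u * u + u + 1#)
        ≈⟨ +-cong (trans (*-congˡ inverse) (*-identityʳ u)) (trans (*-congˡ root) (zeroʳ c)) ⟩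
      u + 0#
        ≈⟨ +-identityʳ u ⟩
      u ∎

  weightedSum : (ℕ → Carrier) → ℕ → List Carrier → Carrier
  weightedSum f j [] = 0#
  weightedSum f j (x ∷ xs) = x * f j + weightedSum f (suc j) xs

  weightedSum-cong : ∀ {f g} → (∀ k → f k ≈ g k) → ∀ j xs → weightedSum f j xs ≈ weightedSum g j xs
  weightedSum-cong f≈g j [] = refl
  weightedSum-cong f≈g j (x ∷ xs) = +-cong (*-congˡ (f≈g j)) (weightedSum-cong f≈g (suc j) xs)

  weightedSum-+ : ∀ f g j xs → weightedSum f j xs + weightedSum g j xs ≈ weightedSum (λ k → f k + g k) j xs
  weightedSum-+ f g j [] = +-identityʳ 0#
  weightedSum-+ f g j (x ∷ xs) =
    trans (interchange _ _ _ _) (+-cong (sym (distribˡ x (f j) (g j))) (weightedSum-+ f g (suc j) xs))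

  weightedSum-*ˡ : ∀ y f j xs → y * weightedSum f j xs ≈ weightedSum (λ k → y * f k) j xs
  weightedSum-*ˡ y f j [] = zeroʳ y
  weightedSum-*ˡ y f j (x ∷ xs) =
    trans (distribˡ y _ _) (+-cong (x∙yz≈y∙xz y x (f j)) (weightedSum-*ˡ y f (suc j) xs))

  weightedSum-*ʳ : ∀ y f j xs → weightedSum f j xs * y ≈ weightedSum (λ k → f k * y) j xs
  weightedSum-*ʳ y f j [] = zeroˡ y
  weightedSum-*ʳ y f j (x ∷ xs) =
    trans (distribʳ y _ _) (+-cong (*-assoc x (f j) y) (weightedSum-*ʳ y f (suc j) xs))

  weightedSum-linear : ∀ α β f g j xs →
    α * weightedSum f j xs + β * weightedSum g j xs ≈ weightedSum (λ k → α * f k + β * g k) j xs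
  weightedSum-linear α β f g j xs =
    trans (+-cong (weightedSum-*ˡ α f j xs) (weightedSum-*ˡ β g j xs)) (weightedSum-+ _ _ j xs)

  weightedSum-cong-support : ∀ {f g} j xs →
    (∀ k → coefAt R xs k * f (j +ℕ k) ≈ coefAt R xs k * g (j +ℕ k)) → weightedSum f j xs ≈ weightedSum g j xs
  weightedSum-cong-support j [] _ = refl
  weightedSum-cong-support {f} {g} j (x ∷ xs) agree =
    +-cong (≡.subst (λ n → x * f n ≈ x * g n) (ℕP.+-identityʳ j) (agree 0))
           (weightedSum-cong-support (suc j) xs λ k →
              ≡.subst (λ n → coefAt R xs k * f n ≈ coefAt R xs k * g n) (ℕP.+-suc j k) (agree (suc k)))

  derivativeCoefficients : ℕ → ℕ → List Carrier → List Carrier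
  derivativeCoefficients L j [] = []
  derivativeCoefficients L j (x ∷ xs) = (nat R j * x - nat R L * x) ∷ derivativeCoefficients L (suc j) xs

  -- the coefficient of x^i in x^(L - j) S(x)
  truncation : ℕ → Series R → ℕ → ℕ → Carrier
  truncation L S i j = if does (L ≤? j +ℕ i) then S (j +ℕ i ∸ L) else 0#

  truncation-yes : ∀ L S i j → L ≤ j +ℕ i → truncation L S i j ≡ S (j +ℕ i ∸ L)
  truncation-yes L S i j le = ≡.cong (if_then S (j +ℕ i ∸ L) else 0#) (dec-true (L ≤? j +ℕ i) le)

  truncation-no : ∀ L S i j → ¬ L ≤ j +ℕ i → truncation L S i j ≡ 0#
  truncation-no L S i j nle = ≡.cong (if_then S (j +ℕ i ∸ L) else 0#) (dec-false (L ≤? j +ℕ i) nle)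

  -- The loops of evalL, derivL and nonnegCoef are where-bound in Defs and cannot be named. Each one is
  -- identified with an explicit recursion through its defining clauses: the uniqueness lemma is applied
  -- (as 'loop') outside the 'with' that generalises the loop's arguments, so that unification against the
  -- generalised goal can solve for the unnamed loop.
  private
    weightedSum-unique : ∀ {f} {g : ℕ → List Carrier → Carrier} →
      (∀ j → g j [] ≡ 0#) → (∀ j x xs → g j (x ∷ xs) ≡ x * f j + g (suc j) xs) →
      ∀ j xs → g j xs ≡ weightedSum f j xs
    weightedSum-unique nil cons j [] = nil j
    weightedSum-unique {f} {g} nil cons j (x ∷ xs) =
      ≡.trans (cons j x xs) (≡.cong (_+_ (x * f j)) (weightedSum-unique {g = g} nil cons (suc j) xs))

    derivativeCoefficients-unique : ∀ L {g : ℕ → List Carrier → List Carrier} →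
      (∀ j → g j [] ≡ []) → (∀ j x xs → g j (x ∷ xs) ≡ (nat R j * x - nat R L * x) ∷ g (suc j) xs) →
      ∀ j xs → g j xs ≡ derivativeCoefficients L j xs
    derivativeCoefficients-unique L nil cons j [] = nil j
    derivativeCoefficients-unique L {g} nil cons j (x ∷ xs) =
      ≡.trans (cons j x xs) (≡.cong (_ ∷_) (derivativeCoefficients-unique L {g} nil cons (suc j) xs))

    module NonnegLoop (L : ℕ) (S : Series R) (i : ℕ)
      {h : (j : ℕ) → Carrier → List Carrier → Dec (L ≤ j +ℕ i) → Carrier} where
      next : ℕ → List Carrier → Carrier
      next j [] = 0#
      next j (x ∷ xs) = h j x xs (L ≤? j +ℕ i)

      module _ (yes-step : ∀ j x xs le → h j x xs (yes le) ≡ x * S (j +ℕ i ∸ L) + next (suc j) xs)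
               (no-step : ∀ j x xs nle → h j x xs (no nle) ≡ 0# + next (suc j) xs) where
        mutual
          step-weightedSum : ∀ j x xs d → h j x xs d ≈ weightedSum (truncation L S i) j (x ∷ xs)
          step-weightedSum j x xs (yes le) = trans (reflexive (yes-step j x xs le))
            (+-cong (*-congˡ (reflexive (≡.sym (truncation-yes L S i j le))))
                    (next-weightedSum (suc j) xs))
          step-weightedSum j x xs (no nle) = trans (reflexive (no-step j x xs nle))
            (+-cong (trans (sym (zeroʳ x)) (*-congˡ (reflexive (≡.sym (truncation-no L S i j nle)))))
                    (next-weightedSum (suc j) xs))

          next-weightedSum : ∀ j xs → next j xs ≈ weightedSum (truncation L S i) j xs
          next-weightedSum j [] = refl
          next-weightedSum j (x ∷ xs) = step-weightedSum j x xs (L ≤? j +ℕ i)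

  evalL-weightedSum : ∀ u v p → evalL R u v p ≡ weightedSum (pow R u) 0 (cs p) * pow R v (low p)
  evalL-weightedSum u v p = generalised
    where
    loop = weightedSum-unique {f = pow R u} (λ _ → ≡.refl) (λ _ _ _ → ≡.refl)
    generalised : evalL R u v p ≡ weightedSum (pow R u) 0 (cs p) * pow R v (low p)
    generalised with 0 | cs p
    ... | j | xs = ≡.cong (_* pow R v (low p)) (loop j xs)

  derivL-coefficients : ∀ p → cs (derivL R p) ≡ derivativeCoefficients (low p) 0 (cs p)
  derivL-coefficients p = generalised
    where
    loop = derivativeCoefficients-unique (low p) (λ _ → ≡.refl) (λ _ _ _ → ≡.refl)
    generalised : cs (derivL R p) ≡ derivativeCoefficients (low p) 0 (cs p)
    generalised with 0 | cs p
    ... | j | xs = loop j xs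

  weightedSum-derivativeCoefficients : ∀ f L j xs →
    weightedSum f j (derivativeCoefficients L j xs) ≈ weightedSum (λ k → (nat R k - nat R L) * f k) j xs
  weightedSum-derivativeCoefficients f L j [] = refl
  weightedSum-derivativeCoefficients f L j (x ∷ xs) = +-cong
    (solve 4 (λ nj nL x y → (nj :* x :- nL :* x) :* y := x :* ((nj :- nL) :* y)) refl (nat R j) (nat R L) x (f j))
    (weightedSum-derivativeCoefficients f L (suc j) xs)

  weightedSum-derivL : ∀ f p →
    weightedSum f 0 (cs (derivL R p)) ≈ weightedSum (λ k → (nat R k - nat R (low p)) * f k) 0 (cs p)
  weightedSum-derivL f p = trans (reflexive (≡.cong (weightedSum f 0) (derivL-coefficients p)))
                                 (weightedSum-derivativeCoefficients f (low p) 0 (cs p))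

  nonnegCoef-weightedSum : ∀ p S i → nonnegCoef R p S i ≈ weightedSum (truncation (low p) S i) 0 (cs p)
  nonnegCoef-weightedSum p S i = generalised
    where
    loop = NonnegLoop.step-weightedSum (low p) S i
      (λ { _ _ [] _ → ≡.refl ; _ _ (_ ∷ _) _ → ≡.refl })
      (λ { _ _ [] _ → ≡.refl ; _ _ (_ ∷ _) _ → ≡.refl })
    generalised : nonnegCoef R p S i ≈ weightedSum (truncation (low p) S i) 0 (cs p)
    generalised with 0 | cs p
    ... | j | [] = refl
    ... | j | x ∷ xs with low p ≤? j +ℕ i
    ...   | d = loop j x xs d

  VanishesDownTo : ℕ → (ℤ → Carrier) → Set ℓ
  VanishesDownTo d Φ = ∀ n → 0 < n → n ≤ d → Φ (ℤ.- (+ n)) ≈ 0#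

  vanishesDownTo-mono : ∀ {d d′ Φ} → d ≤ d′ → VanishesDownTo d′ Φ → VanishesDownTo d Φ
  vanishesDownTo-mono d≤d′ vanish n 0<n n≤d = vanish n 0<n (ℕP.≤-trans n≤d d≤d′)

  truncation-≈ : ∀ {S Φ d} → (∀ n → S n ≈ Φ (+ n)) → VanishesDownTo d Φ →
    ∀ L i j x → (j +ℕ d < L → x ≈ 0#) → x * truncation L S i j ≈ x * Φ ((j +ℕ i) ⊖ L)
  truncation-≈ {S} {Φ} {d} S≈Φ vanish L i j x support with L ≤? j +ℕ i
  ... | yes L≤ = *-congˡ (begin
    truncation L S i j     ≡⟨ truncation-yes L S i j L≤ ⟩
    S (j +ℕ i ∸ L)         ≈⟨ S≈Φ _ ⟩
    Φ (+ (j +ℕ i ∸ L))     ≡⟨ ≡.cong Φ (ℤP.⊖-≥ L≤) ⟨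
    Φ ((j +ℕ i) ⊖ L)       ∎)
  ... | no L≰ with j +ℕ d <? L
  ...   | yes outside = begin
    x * truncation L S i j ≈⟨ *-congʳ (support outside) ⟩
    0# * truncation L S i j ≈⟨ zeroˡ _ ⟩
    0#                     ≈⟨ zeroˡ _ ⟨
    0# * Φ ((j +ℕ i) ⊖ L)  ≈⟨ *-congʳ (support outside) ⟨
    x * Φ ((j +ℕ i) ⊖ L)   ∎
  ...   | no inside = *-congˡ (begin
    truncation L S i j        ≡⟨ truncation-no L S i j L≰ ⟩
    0#                        ≈⟨ vanish (L ∸ (j +ℕ i)) (ℕP.m<n⇒0<n∸m j+i<L) depth ⟨
    Φ (ℤ.- (+ (L ∸ (j +ℕ i)))) ≡⟨ ≡.cong Φ (ℤP.⊖-< j+i<L) ⟨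
    Φ ((j +ℕ i) ⊖ L)          ∎)
    where
    j+i<L : j +ℕ i < L
    j+i<L = ℕP.≰⇒> L≰
    depth : L ∸ (j +ℕ i) ≤ d
    depth = ℕP.≤-trans (ℕP.∸-monoʳ-≤ L (ℕP.m≤m+n j i)) (ℕP.m≤n+o⇒m∸n≤o L j (ℕP.≮⇒≥ inside))

  nonnegCoef-expansion : ∀ (S : Series R) (Φ : ℤ → Carrier) d →
    (∀ n → S n ≈ Φ (+ n)) → VanishesDownTo d Φ → ∀ p → InXbarPow R d p →
    ∀ i → nonnegCoef R p S i ≈ weightedSum (λ j → Φ ((j +ℕ i) ⊖ low p)) 0 (cs p)
  nonnegCoef-expansion S Φ d S≈Φ vanish p support i = trans (nonnegCoef-weightedSum p S i)
    (weightedSum-cong-support 0 (cs p) λ j →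
       truncation-≈ {S} {Φ} S≈Φ vanish (low p) i j (coefAt R (cs p) j) (support j))

  sumTo-cong : ∀ n {f g} → (∀ k → k ≤ n → f k ≈ g k) → sumTo R n f ≈ sumTo R n g
  sumTo-cong zero f≈g = f≈g 0 z≤n
  sumTo-cong (suc n) f≈g =
    +-cong (sumTo-cong n λ k k≤n → f≈g k (ℕP.m≤n⇒m≤1+n k≤n)) (f≈g (suc n) ℕP.≤-refl)

  sumTo-+ : ∀ n f g → sumTo R n f + sumTo R n g ≈ sumTo R n (λ k → f k + g k)
  sumTo-+ zero f g = refl
  sumTo-+ (suc n) f g = trans (interchange _ _ _ _) (+-congʳ (sumTo-+ n f g))

  sumTo-const : ∀ n x → sumTo R n (λ _ → x) ≈ nat R (suc n) * x
  sumTo-const zero x = sym (trans (distribʳ x 1# 0#) (trans (+-cong (*-identityˡ x) (zeroˡ x)) (+-identityʳ x)))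
  sumTo-const (suc n) x = begin
    sumTo R n (λ _ → x) + x      ≈⟨ +-cong (sumTo-const n x) (sym (*-identityˡ x)) ⟩
    nat R (suc n) * x + 1# * x   ≈⟨ +-comm _ _ ⟩
    1# * x + nat R (suc n) * x   ≈⟨ distribʳ x 1# _ ⟨
    nat R (suc (suc n)) * x      ∎

  geom-⋆-geom : ∀ u i → _⋆_ R (geom R u) (geom R u) i ≈ nat R (suc i) * pow R u i
  geom-⋆-geom u i = trans (sumTo-cong i λ k k≤i → begin
      pow R u k * pow R u (i ∸ k) ≈⟨ pow-+ u k (i ∸ k) ⟨
      pow R u (k +ℕ (i ∸ k))      ≡⟨ ≡.cong (pow R u) (ℕP.m+[n∸m]≡n k≤i) ⟩
      pow R u i                   ∎)
    (sumTo-const i (pow R u i))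

  Recurrence : (ℕ → Carrier) → (ℕ → Carrier) → Set ℓ
  Recurrence f s = ∀ n → s (suc (suc n)) + (s (suc n) + s n) ≈ f n

  recurrence-unique : ∀ {f g s t} → Recurrence f s → Recurrence g t → (∀ n → f n ≈ g n) →
    s 0 ≈ t 0 → s 1 ≈ t 1 → ∀ n → s n ≈ t n
  recurrence-unique {f} {g} {s} {t} rec-s rec-t f≈g s₀≈t₀ s₁≈t₁ n = proj₁ (consecutive n)
    where
    consecutive : ∀ n → s n ≈ t n × s (suc n) ≈ t (suc n)
    consecutive zero = s₀≈t₀ , s₁≈t₁
    consecutive (suc n) = s₁ , +-cancelʳ (t (suc n) + t n) _ _ (begin
      s (suc (suc n)) + (t (suc n) + t n) ≈⟨ +-congˡ (+-cong s₁ s₀) ⟨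
      s (suc (suc n)) + (s (suc n) + s n) ≈⟨ rec-s n ⟩
      f n                                 ≈⟨ f≈g n ⟩
      g n                                 ≈⟨ rec-t n ⟨
      t (suc (suc n)) + (t (suc n) + t n) ∎)
      where
      s₀ : s n ≈ t n
      s₀ = proj₁ (consecutive n)
      s₁ : s (suc n) ≈ t (suc n)
      s₁ = proj₂ (consecutive n)

  invQ-recurrence : Recurrence (λ _ → 0#) (invQ R)
  invQ-recurrence n = -‿inverseˡ _

  -- (1 + x + x²) h = 1 implies (1 + x + x²) (g ⋆ h) = g.
  ⋆-recurrence : ∀ g h → Recurrence (λ _ → 0#) h → h 0 ≈ 1# → h 1 + h 0 ≈ 0# →
    Recurrence (λ n → g (suc (suc n))) (_⋆_ R g h)
  ⋆-recurrence g h rec-h h₀≈1 h₁+h₀≈0 n = begin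
    ((Σ₂ + F₂ (suc n)) + F₂ (suc (suc n))) + ((Σ₁ + F₁ (suc n)) + Σ₀)
      ≈⟨ solve 6 (λ Σ₂ Σ₁ Σ₀ x y z →
             ((Σ₂ :+ x) :+ y) :+ ((Σ₁ :+ z) :+ Σ₀) := (Σ₂ :+ (Σ₁ :+ Σ₀)) :+ ((x :+ z) :+ y))
           refl Σ₂ Σ₁ Σ₀ (F₂ (suc n)) (F₂ (suc (suc n))) (F₁ (suc n)) ⟩
    (Σ₂ + (Σ₁ + Σ₀)) + ((F₂ (suc n) + F₁ (suc n)) + F₂ (suc (suc n)))
      ≈⟨ +-cong interior boundary ⟩
    0# + g (suc (suc n))
      ≈⟨ +-identityˡ _ ⟩
    g (suc (suc n)) ∎
    where
    F₂ F₁ F₀ : ℕ → Carrier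
    F₂ k = g k * h (suc (suc n) ∸ k)
    F₁ k = g k * h (suc n ∸ k)
    F₀ k = g k * h (n ∸ k)
    Σ₂ Σ₁ Σ₀ : Carrier
    Σ₂ = sumTo R n F₂
    Σ₁ = sumTo R n F₁
    Σ₀ = sumTo R n F₀

    interior : Σ₂ + (Σ₁ + Σ₀) ≈ 0#
    interior = begin
      Σ₂ + (Σ₁ + Σ₀)                                    ≈⟨ +-congˡ (sumTo-+ n F₁ F₀) ⟩
      Σ₂ + sumTo R n (λ k → F₁ k + F₀ k)                ≈⟨ sumTo-+ n F₂ _ ⟩
      sumTo R n (λ k → F₂ k + (F₁ k + F₀ k))            ≈⟨ sumTo-cong n vanishing ⟩
      sumTo R n (λ _ → 0#)                              ≈⟨ sumTo-const n 0# ⟩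
      nat R (suc n) * 0#                                ≈⟨ zeroʳ _ ⟩
      0#                                                ∎
      where
      vanishing : ∀ k → k ≤ n → F₂ k + (F₁ k + F₀ k) ≈ 0#
      vanishing k k≤n = begin
        g k * h (suc (suc n) ∸ k) + (g k * h (suc n ∸ k) + g k * h (n ∸ k))
          ≡⟨ ≡.cong₂ (λ m m′ → g k * h m + (g k * h m′ + g k * h (n ∸ k)))
                     (ℕP.+-∸-assoc 2 k≤n) (ℕP.+-∸-assoc 1 k≤n) ⟩
        g k * h (suc (suc (n ∸ k))) + (g k * h (suc (n ∸ k)) + g k * h (n ∸ k))
          ≈⟨ trans (+-congˡ (sym (distribˡ _ _ _))) (sym (distribˡ _ _ _)) ⟩
        g k * (h (suc (suc (n ∸ k))) + (h (suc (n ∸ k)) + h (n ∸ k)))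
          ≈⟨ *-congˡ (rec-h (n ∸ k)) ⟩
        g k * 0#
          ≈⟨ zeroʳ _ ⟩
        0# ∎

    boundary : (F₂ (suc n) + F₁ (suc n)) + F₂ (suc (suc n)) ≈ g (suc (suc n))
    boundary = begin
      (g (suc n) * h (suc n ∸ n) + g (suc n) * h (n ∸ n)) + g (suc (suc n)) * h (n ∸ n)
        ≡⟨ ≡.cong₂ (λ m m′ → (g (suc n) * h m + g (suc n) * h m′) + g (suc (suc n)) * h m′)
                  (ℕP.m+n∸n≡m 1 n) (ℕP.n∸n≡0 n) ⟩
      (g (suc n) * h 1 + g (suc n) * h 0) + g (suc (suc n)) * h 0
        ≈⟨ +-cong (trans (sym (distribˡ _ _ _)) (trans (*-congˡ h₁+h₀≈0) (zeroʳ _))) (*-congˡ h₀≈1) ⟩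
      0# + g (suc (suc n)) * 1#
        ≈⟨ trans (+-identityˡ _) (*-identityʳ _) ⟩
      g (suc (suc n)) ∎

  int : ℤ → Carrier
  int (+ n) = nat R n
  int -[1+ n ] = - nat R (suc n)

  int-suc : ∀ z → int (ℤ.suc z) ≈ 1# + int z
  int-suc (+ n) = refl
  int-suc -[1+ zero ] = sym (trans (+-congˡ (-‿cong (+-identityʳ 1#))) (-‿inverseʳ 1#))
  int-suc -[1+ suc n ] = solve 1 (λ x → :- x := κ 1 :+ :- (κ 1 :+ x)) refl (nat R (suc n))

  int-⊖ : ∀ m n → int (m ⊖ n) ≈ nat R m - nat R n
  int-⊖ m zero = sym (trans (+-congˡ -0#≈0#) (+-identityʳ _))
  int-⊖ zero (suc n) = sym (+-identityˡ _)
  int-⊖ (suc m) (suc n) rewrite ℤP.[1+m]⊖[1+n]≡m⊖n m n =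
    trans (int-⊖ m n) (solve 2 (λ x y → x :- y := (κ 1 :+ x) :- (κ 1 :+ y)) refl (nat R m) (nat R n))

  exponent-weight : ∀ j i L → (nat R j - nat R L) + nat R (suc i) ≈ 1# + int ((j +ℕ i) ⊖ L)
  exponent-weight j i L = begin
    (nat R j - nat R L) + (1# + nat R i)
      ≈⟨ solve 3 (λ x y z → (x :- z) :+ (κ 1 :+ y) := κ 1 :+ ((x :+ y) :- z)) refl (nat R j) (nat R i) (nat R L) ⟩
    1# + ((nat R j + nat R i) - nat R L)
      ≈⟨ +-congˡ (+-congʳ (nat-+ j i)) ⟨
    1# + (nat R (j +ℕ i) - nat R L)
      ≈⟨ +-congˡ (int-⊖ (j +ℕ i) L) ⟨
    1# + int ((j +ℕ i) ⊖ L) ∎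

  module Exponential (u v : Carrier) (uv≈1 : u * v ≈ 1#) where
    zpow : ℤ → Carrier
    zpow (+ n) = pow R u n
    zpow -[1+ n ] = pow R v (suc n)

    zpow-suc : ∀ z → zpow (ℤ.suc z) ≈ u * zpow z
    zpow-suc (+ n) = refl
    zpow-suc -[1+ zero ] = sym (trans (*-congˡ (*-identityʳ v)) uv≈1)
    zpow-suc -[1+ suc n ] = sym (trans (sym (*-assoc _ _ _)) (trans (*-congʳ uv≈1) (*-identityˡ _)))

    zpow-recurrence : u * u + u + 1# ≈ 0# →
      ∀ z → zpow (ℤ.suc (ℤ.suc z)) + (zpow (ℤ.suc z) + zpow z) ≈ 0#
    zpow-recurrence root z = begin
      zpow (ℤ.suc (ℤ.suc z)) + (zpow (ℤ.suc z) + zpow z)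
        ≈⟨ +-cong (trans (zpow-suc (ℤ.suc z)) (*-congˡ (zpow-suc z))) (+-congʳ (zpow-suc z)) ⟩
      u * (u * zpow z) + (u * zpow z + zpow z)
        ≈⟨ solve 2 (λ u x → u :* (u :* x) :+ (u :* x :+ x) := (u :* u :+ u :+ κ 1) :* x) refl u (zpow z) ⟩
      (u * u + u + 1#) * zpow z
        ≈⟨ trans (*-congʳ root) (zeroˡ _) ⟩
      0# ∎

    zpow-⊖ : ∀ m n → zpow (m ⊖ n) ≈ pow R u m * pow R v n
    zpow-⊖ m zero = sym (*-identityʳ _)
    zpow-⊖ zero (suc n) = sym (*-identityˡ _)
    zpow-⊖ (suc m) (suc n) rewrite ℤP.[1+m]⊖[1+n]≡m⊖n m n = begin
      zpow (m ⊖ n)                      ≈⟨ zpow-⊖ m n ⟩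
      pow R u m * pow R v n             ≈⟨ *-identityˡ _ ⟨
      1# * (pow R u m * pow R v n)      ≈⟨ *-congʳ uv≈1 ⟨
      (u * v) * (pow R u m * pow R v n)
        ≈⟨ solve 4 (λ u v x y → (u :* v) :* (x :* y) := (u :* x) :* (v :* y)) refl u v (pow R u m) (pow R v n) ⟩
      (u * pow R u m) * (v * pow R v n) ∎

    monomial : ∀ j L i → (pow R u j * pow R v L) * pow R u i ≈ zpow ((j +ℕ i) ⊖ L)
    monomial j L i = begin
      (pow R u j * pow R v L) * pow R u i
        ≈⟨ solve 3 (λ x y z → (x :* y) :* z := (x :* z) :* y) refl (pow R u j) (pow R v L) (pow R u i) ⟩
      (pow R u j * pow R u i) * pow R v L
        ≈⟨ *-congʳ (pow-+ u j i) ⟨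
      pow R u (j +ℕ i) * pow R v L
        ≈⟨ zpow-⊖ (j +ℕ i) L ⟨
      zpow ((j +ℕ i) ⊖ L) ∎

    weighted-expansion : ∀ (w : ℕ → Carrier) L i xs →
      (weightedSum (λ k → w k * pow R u k) 0 xs * pow R v L) * pow R u i
        ≈ weightedSum (λ k → w k * zpow ((k +ℕ i) ⊖ L)) 0 xs
    weighted-expansion w L i xs =
      trans (trans (*-congʳ (weightedSum-*ʳ _ _ 0 xs)) (weightedSum-*ʳ _ _ 0 xs))
            (weightedSum-cong (λ k → trans (trans (*-congʳ (*-assoc _ _ _)) (*-assoc _ _ _))
                                           (*-congˡ (monomial k L i))) 0 xs)

    evalL-expansion : ∀ p i →
      evalL R u v p * pow R u i ≈ weightedSum (λ j → zpow ((j +ℕ i) ⊖ low p)) 0 (cs p)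
    evalL-expansion p i = begin
      evalL R u v p * pow R u i
        ≡⟨ ≡.cong (_* pow R u i) (evalL-weightedSum u v p) ⟩
      (weightedSum (pow R u) 0 (cs p) * pow R v (low p)) * pow R u i
        ≈⟨ *-congʳ (*-congʳ (weightedSum-cong (λ k → sym (*-identityˡ _)) 0 (cs p))) ⟩
      (weightedSum (λ k → 1# * pow R u k) 0 (cs p) * pow R v (low p)) * pow R u i
        ≈⟨ weighted-expansion (λ _ → 1#) (low p) i (cs p) ⟩
      weightedSum (λ j → 1# * zpow ((j +ℕ i) ⊖ low p)) 0 (cs p)
        ≈⟨ weightedSum-cong (λ k → *-identityˡ _) 0 (cs p) ⟩
      weightedSum (λ j → zpow ((j +ℕ i) ⊖ low p)) 0 (cs p) ∎

    evalL-derivL-expansion : ∀ p i → (u * evalL R u v (derivL R p)) * pow R u i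
      ≈ weightedSum (λ j → (nat R j - nat R (low p)) * zpow ((j +ℕ i) ⊖ low p)) 0 (cs p)
    evalL-derivL-expansion p i = begin
      (u * evalL R u v (derivL R p)) * pow R u i
        ≡⟨ ≡.cong (λ e → (u * e) * pow R u i) (evalL-weightedSum u v (derivL R p)) ⟩
      (u * (Σ′ * (v * pow R v L))) * pow R u i
        ≈⟨ *-congʳ (solve 4 (λ u v s y → u :* (s :* (v :* y)) := (s :* y) :* (u :* v)) refl u v Σ′ (pow R v L)) ⟩
      ((Σ′ * pow R v L) * (u * v)) * pow R u i
        ≈⟨ *-congʳ (trans (*-congˡ uv≈1) (*-identityʳ _)) ⟩
      (Σ′ * pow R v L) * pow R u i
        ≈⟨ *-congʳ (*-congʳ (weightedSum-derivL (pow R u) p)) ⟩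
      (weightedSum (λ k → (nat R k - nat R L) * pow R u k) 0 (cs p) * pow R v L) * pow R u i
        ≈⟨ weighted-expansion (λ k → nat R k - nat R L) L i (cs p) ⟩
      weightedSum (λ j → (nat R j - nat R L) * zpow ((j +ℕ i) ⊖ L)) 0 (cs p) ∎
      where
      L : ℕ
      L = low p
      Σ′ : Carrier
      Σ′ = weightedSum (pow R u) 0 (cs (derivL R p))

    second-order-expansion : ∀ p i →
      (u * evalL R u v (derivL R p)) * pow R u i + evalL R u v p * _⋆_ R (geom R u) (geom R u) i
        ≈ weightedSum (λ j → ((nat R j - nat R (low p)) + nat R (suc i)) * zpow ((j +ℕ i) ⊖ low p)) 0 (cs p)
    second-order-expansion p i = begin
      (u * evalL R u v (derivL R p)) * pow R u i + evalL R u v p * _⋆_ R (geom R u) (geom R u) i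
        ≈⟨ +-cong (evalL-derivL-expansion p i) (*-congˡ (geom-⋆-geom u i)) ⟩
      Σ (λ j → e j * Z j) + evalL R u v p * (nat R (suc i) * pow R u i)
        ≈⟨ +-congˡ (x∙yz≈y∙xz _ _ _) ⟩
      Σ (λ j → e j * Z j) + nat R (suc i) * (evalL R u v p * pow R u i)
        ≈⟨ +-congˡ (*-congˡ (evalL-expansion p i)) ⟩
      Σ (λ j → e j * Z j) + nat R (suc i) * Σ Z
        ≈⟨ +-congˡ (weightedSum-*ˡ _ Z 0 (cs p)) ⟩
      Σ (λ j → e j * Z j) + Σ (λ j → nat R (suc i) * Z j)
        ≈⟨ trans (weightedSum-+ _ _ 0 (cs p)) (weightedSum-cong (λ j → sym (distribʳ _ _ _)) 0 (cs p)) ⟩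
      Σ (λ j → (e j + nat R (suc i)) * Z j) ∎
      where
      Σ : (ℕ → Carrier) → Carrier
      Σ f = weightedSum f 0 (cs p)
      e Z : ℕ → Carrier
      e j = nat R j - nat R (low p)
      Z j = zpow ((j +ℕ i) ⊖ low p)

module _ {c ℓ : Level} (R : CommutativeRing c ℓ) where
  open CommutativeRing R
  open import Relation.Binary.Reasoning.Setoid setoid
  open IntegerCoefficients R
  open LaurentExpansion R

  module CubeRoots (ζ ζ̄ : Carrier) (ζ+ζ̄+1≈0 : ζ + ζ̄ + 1# ≈ 0#) (ζζ̄≈1 : ζ * ζ̄ ≈ 1#)
    (a : Carrier) (a-inverse : (1# - ζ) * a ≈ 1#)
    (b : Carrier) (b-inverse : (1# - ζ̄) * b ≈ 1#)
    (twoThirds : Carrier) (twoThirds-spec : (1# + 1# + 1#) * twoThirds ≈ 1# + 1#) where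

    open Identities R ζ ζ̄ a b twoThirds

    ζ̄ζ≈1 : ζ̄ * ζ ≈ 1#
    ζ̄ζ≈1 = trans (*-comm ζ̄ ζ) ζζ̄≈1

    private
      module Z = Exponential ζ ζ̄ ζζ̄≈1
      module Z̄ = Exponential ζ̄ ζ ζ̄ζ≈1

      ζζ̄-1≈0 : ζ * ζ̄ - 1# ≈ 0#
      ζζ̄-1≈0 = x≈y⇒x-y≈0 ζζ̄≈1

    ζ-root : ζ * ζ + ζ + 1# ≈ 0#
    ζ-root = modulo (- 1#) ζζ̄-1≈0 (modulo ζ ζ+ζ̄+1≈0 (solve 2 (λ ζ ζ̄ →
      ζ :* ζ :+ ζ :+ κ 1 := (κ 0 :+ (:- κ 1) :* (ζ :* ζ̄ :- κ 1)) :+ ζ :* (ζ :+ ζ̄ :+ κ 1)) refl ζ ζ̄))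

    ζ̄-root : ζ̄ * ζ̄ + ζ̄ + 1# ≈ 0#
    ζ̄-root = modulo (- 1#) ζζ̄-1≈0 (modulo ζ̄ ζ+ζ̄+1≈0 (solve 2 (λ ζ ζ̄ →
      ζ̄ :* ζ̄ :+ ζ̄ :+ κ 1 := (κ 0 :+ (:- κ 1) :* (ζ :* ζ̄ :- κ 1)) :+ ζ̄ :* (ζ :+ ζ̄ :+ κ 1))
      refl ζ ζ̄))

    private
      module Rζ = Root ζ-root a-inverse
      module Rζ̄ = Root ζ̄-root b-inverse

    -- (1 - ζ) (1 - ζ̄) = 3
    three-ab≈1 : (1# + 1# + 1#) * (a * b) ≈ 1#
    three-ab≈1 = begin
      (1# + 1# + 1#) * (a * b)
        ≈⟨ modulo (- (a * b)) ζζ̄-1≈0 (modulo (a * b) ζ+ζ̄+1≈0 (solve 4 (λ ζ ζ̄ a b →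
             (κ 1 :+ κ 1 :+ κ 1) :* (a :* b)
               := ((κ 1 :- ζ) :* a) :* ((κ 1 :- ζ̄) :* b)
                  :+ (:- (a :* b)) :* (ζ :* ζ̄ :- κ 1) :+ (a :* b) :* (ζ :+ ζ̄ :+ κ 1))
             refl ζ ζ̄ a b)) ⟩
      ((1# - ζ) * a) * ((1# - ζ̄) * b) ≈⟨ *-cong a-inverse b-inverse ⟩
      1# * 1#                         ≈⟨ *-identityˡ 1# ⟩
      1#                              ∎

    a+b≈1 : a + b ≈ 1#
    a+b≈1 = begin
      a + b
        ≈⟨ +-cong (trans (*-congˡ b-inverse) (*-identityʳ a))
                  (trans (*-congˡ a-inverse) (*-identityʳ b)) ⟨
      a * ((1# - ζ̄) * b) + b * ((1# - ζ) * a)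
        ≈⟨ modulo (- (a * b)) ζ+ζ̄+1≈0 (solve 4 (λ ζ ζ̄ a b →
             a :* ((κ 1 :- ζ̄) :* b) :+ b :* ((κ 1 :- ζ) :* a)
               := (κ 1 :+ κ 1 :+ κ 1) :* (a :* b) :+ (:- (a :* b)) :* (ζ :+ ζ̄ :+ κ 1))
             refl ζ ζ̄ a b) ⟩
      (1# + 1# + 1#) * (a * b)
        ≈⟨ three-ab≈1 ⟩
      1# ∎

    twoThirds≈2ab : twoThirds ≈ (1# + 1#) * (a * b)
    twoThirds≈2ab = begin
      twoThirds
        ≈⟨ trans (*-congˡ three-ab≈1) (*-identityʳ twoThirds) ⟨
      twoThirds * ((1# + 1# + 1#) * (a * b))
        ≈⟨ solve 2 (λ t p → t :* ((κ 1 :+ κ 1 :+ κ 1) :* p) := ((κ 1 :+ κ 1 :+ κ 1) :* t) :* p)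
             refl twoThirds (a * b) ⟩
      ((1# + 1# + 1#) * twoThirds) * (a * b)
        ≈⟨ *-congʳ twoThirds-spec ⟩
      (1# + 1#) * (a * b) ∎

    conjugateSum : Carrier → Carrier → ℤ → Carrier
    conjugateSum α β z = α * Z.zpow z + β * Z̄.zpow z

    conjugateSum-recurrence : ∀ α β z →
      conjugateSum α β (ℤ.suc (ℤ.suc z)) + (conjugateSum α β (ℤ.suc z) + conjugateSum α β z) ≈ 0#
    conjugateSum-recurrence α β z = begin
      (α * X₂ + β * Y₂) + ((α * X₁ + β * Y₁) + (α * X₀ + β * Y₀))
        ≈⟨ solve 8 (λ α β x₂ x₁ x₀ y₂ y₁ y₀ →
             (α :* x₂ :+ β :* y₂) :+ ((α :* x₁ :+ β :* y₁) :+ (α :* x₀ :+ β :* y₀))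
               := α :* (x₂ :+ (x₁ :+ x₀)) :+ β :* (y₂ :+ (y₁ :+ y₀)))
             refl α β X₂ X₁ X₀ Y₂ Y₁ Y₀ ⟩
      α * (X₂ + (X₁ + X₀)) + β * (Y₂ + (Y₁ + Y₀))
        ≈⟨ +-cong (*-congˡ (Z.zpow-recurrence ζ-root z)) (*-congˡ (Z̄.zpow-recurrence ζ̄-root z)) ⟩
      α * 0# + β * 0#
        ≈⟨ trans (+-cong (zeroʳ α) (zeroʳ β)) (+-identityʳ 0#) ⟩
      0# ∎
      where
      X₂ X₁ X₀ Y₂ Y₁ Y₀ : Carrier
      X₂ = Z.zpow (ℤ.suc (ℤ.suc z))
      X₁ = Z.zpow (ℤ.suc z)
      X₀ = Z.zpow z
      Y₂ = Z̄.zpow (ℤ.suc (ℤ.suc z))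
      Y₁ = Z̄.zpow (ℤ.suc z)
      Y₀ = Z̄.zpow z

    U W V : ℤ → Carrier
    U = conjugateSum a b
    W = conjugateSum (a * a) (b * b)
    V z = twoThirds * U z + (1# + int z) * W z

    W-step : ∀ z → (W (ℤ.suc (ℤ.suc z)) + W (ℤ.suc (ℤ.suc z))) + W (ℤ.suc z) ≈ U (ℤ.suc (ℤ.suc z))
    W-step z = begin
      (W (ℤ.suc (ℤ.suc z)) + W (ℤ.suc (ℤ.suc z))) + W (ℤ.suc z)
        ≈⟨ +-congʳ (+-cong W₂ W₂) ⟩
      ((a * a) * (ζ * X) + (b * b) * (ζ̄ * Y) + ((a * a) * (ζ * X) + (b * b) * (ζ̄ * Y)))
        + ((a * a) * X + (b * b) * Y)
        ≈⟨ solve 6 (λ a b ζ ζ̄ x y →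
             ((a :* a) :* (ζ :* x) :+ (b :* b) :* (ζ̄ :* y) :+ ((a :* a) :* (ζ :* x) :+ (b :* b) :* (ζ̄ :* y)))
               :+ ((a :* a) :* x :+ (b :* b) :* y)
             := (a :* x) :* (a :* (ζ :+ ζ :+ κ 1)) :+ (b :* y) :* (b :* (ζ̄ :+ ζ̄ :+ κ 1)))
             refl a b ζ ζ̄ X Y ⟩
      (a * X) * (a * (ζ + ζ + 1#)) + (b * Y) * (b * (ζ̄ + ζ̄ + 1#))
        ≈⟨ +-cong (*-congˡ Rζ.*-twice-root+1) (*-congˡ Rζ̄.*-twice-root+1) ⟩
      (a * X) * ζ + (b * Y) * ζ̄
        ≈⟨ solve 6 (λ a b ζ ζ̄ x y → (a :* x) :* ζ :+ (b :* y) :* ζ̄ := a :* (ζ :* x) :+ b :* (ζ̄ :* y))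
             refl a b ζ ζ̄ X Y ⟩
      a * (ζ * X) + b * (ζ̄ * Y)
        ≈⟨ +-cong (*-congˡ (Z.zpow-suc (ℤ.suc z))) (*-congˡ (Z̄.zpow-suc (ℤ.suc z))) ⟨
      U (ℤ.suc (ℤ.suc z)) ∎
      where
      X Y : Carrier
      X = Z.zpow (ℤ.suc z)
      Y = Z̄.zpow (ℤ.suc z)
      W₂ : W (ℤ.suc (ℤ.suc z)) ≈ (a * a) * (ζ * X) + (b * b) * (ζ̄ * Y)
      W₂ = +-cong (*-congˡ (Z.zpow-suc (ℤ.suc z))) (*-congˡ (Z̄.zpow-suc (ℤ.suc z)))

    V-recurrence : ∀ z → V (ℤ.suc (ℤ.suc z)) + (V (ℤ.suc z) + V z) ≈ U (ℤ.suc (ℤ.suc z))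
    V-recurrence z = begin
      V z₂ + (V z₁ + V z)
        ≈⟨ +-cong (+-congˡ (*-congʳ (+-congˡ (trans (int-suc z₁) (+-congˡ (int-suc z))))))
                  (+-congʳ (+-congˡ (*-congʳ (+-congˡ (int-suc z))))) ⟩
      (twoThirds * U z₂ + (1# + (1# + (1# + k))) * W z₂)
        + ((twoThirds * U z₁ + (1# + (1# + k)) * W z₁) + V z)
        ≈⟨ solve 8 (λ t k u₂ u₁ u₀ w₂ w₁ w₀ →
             (t :* u₂ :+ (κ 1 :+ (κ 1 :+ (κ 1 :+ k))) :* w₂)
               :+ ((t :* u₁ :+ (κ 1 :+ (κ 1 :+ k)) :* w₁) :+ (t :* u₀ :+ (κ 1 :+ k) :* w₀))
             := (t :* (u₂ :+ (u₁ :+ u₀)) :+ (κ 1 :+ k) :* (w₂ :+ (w₁ :+ w₀))) :+ ((w₂ :+ w₂) :+ w₁))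
             refl twoThirds k (U z₂) (U z₁) (U z) (W z₂) (W z₁) (W z) ⟩
      (twoThirds * (U z₂ + (U z₁ + U z)) + (1# + k) * (W z₂ + (W z₁ + W z))) + ((W z₂ + W z₂) + W z₁)
        ≈⟨ +-cong (+-cong (*-congˡ (conjugateSum-recurrence a b z))
                          (*-congˡ (conjugateSum-recurrence (a * a) (b * b) z)))
                  (W-step z) ⟩
      (twoThirds * 0# + (1# + k) * 0#) + U z₂
        ≈⟨ trans (+-congʳ (trans (+-cong (zeroʳ _) (zeroʳ _)) (+-identityʳ 0#))) (+-identityˡ _) ⟩
      U z₂ ∎
      where
      z₁ z₂ : ℤ
      z₁ = ℤ.suc z
      z₂ = ℤ.suc z₁
      k : Carrier
      k = int z

    U₀ : U (+ 0) ≈ 1#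
    U₀ = trans (+-cong (*-identityʳ a) (*-identityʳ b)) a+b≈1

    U₁ : U (+ 1) ≈ - 1#
    U₁ = begin
      a * (ζ * 1#) + b * (ζ̄ * 1#) ≈⟨ +-cong (*-congˡ (*-identityʳ ζ)) (*-congˡ (*-identityʳ ζ̄)) ⟩
      a * ζ + b * ζ̄               ≈⟨ +-cong Rζ.*-root Rζ̄.*-root ⟩
      (a - 1#) + (b - 1#)         ≈⟨ solve 2 (λ a b → (a :- κ 1) :+ (b :- κ 1) := (a :+ b) :- κ 2) refl a b ⟩
      (a + b) - (1# + 1#)         ≈⟨ +-congʳ a+b≈1 ⟩
      1# - (1# + 1#)              ≈⟨ solve 0 (κ 1 :- κ 2 := :- κ 1) refl ⟩
      - 1#                        ∎

    V₀ : V (+ 0) ≈ 1#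
    V₀ = begin
      twoThirds * (a * 1# + b * 1#) + (1# + 0#) * ((a * a) * 1# + (b * b) * 1#)
        ≈⟨ solve 3 (λ t a b →
             t :* (a :* κ 1 :+ b :* κ 1) :+ (κ 1 :+ κ 0) :* ((a :* a) :* κ 1 :+ (b :* b) :* κ 1)
               := t :* (a :+ b) :+ ((a :+ b) :* (a :+ b) :- κ 2 :* (a :* b)))
             refl twoThirds a b ⟩
      twoThirds * (a + b) + ((a + b) * (a + b) - (1# + 1#) * (a * b))
        ≈⟨ +-cong (*-cong twoThirds≈2ab a+b≈1) (+-congʳ (*-cong a+b≈1 a+b≈1)) ⟩
      (1# + 1#) * (a * b) * 1# + (1# * 1# - (1# + 1#) * (a * b))
        ≈⟨ solve 1 (λ p → κ 2 :* p :* κ 1 :+ (κ 1 :* κ 1 :- κ 2 :* p) := κ 1) refl (a * b) ⟩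
      1# ∎

    V₁ : V (+ 1) ≈ - (1# + 1#)
    V₁ = begin
      twoThirds * U (+ 1) + (1# + (1# + 0#)) * ((a * a) * (ζ * 1#) + (b * b) * (ζ̄ * 1#))
        ≈⟨ +-congˡ (solve 4 (λ a b ζ ζ̄ →
             (κ 1 :+ (κ 1 :+ κ 0)) :* ((a :* a) :* (ζ :* κ 1) :+ (b :* b) :* (ζ̄ :* κ 1))
               := κ 2 :* (a :* (a :* ζ) :+ b :* (b :* ζ̄)))
             refl a b ζ ζ̄) ⟩
      twoThirds * U (+ 1) + (1# + 1#) * (a * (a * ζ) + b * (b * ζ̄))
        ≈⟨ +-cong (*-cong twoThirds≈2ab U₁) (*-congˡ (+-cong (*-congˡ Rζ.*-root) (*-congˡ Rζ̄.*-root))) ⟩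
      (1# + 1#) * (a * b) * - 1# + (1# + 1#) * (a * (a - 1#) + b * (b - 1#))
        ≈⟨ solve 2 (λ a b →
             κ 2 :* (a :* b) :* (:- κ 1) :+ κ 2 :* (a :* (a :- κ 1) :+ b :* (b :- κ 1))
               := κ 2 :* ((a :+ b) :* (a :+ b) :- (a :+ b)) :- κ 2 :* ((κ 1 :+ κ 1 :+ κ 1) :* (a :* b)))
             refl a b ⟩
      (1# + 1#) * ((a + b) * (a + b) - (a + b)) - (1# + 1#) * ((1# + 1# + 1#) * (a * b))
        ≈⟨ +-cong (*-congˡ (+-cong (*-cong a+b≈1 a+b≈1) (-‿cong a+b≈1))) (-‿cong (*-congˡ three-ab≈1)) ⟩
      (1# + 1#) * (1# * 1# - 1#) - (1# + 1#) * 1#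
        ≈⟨ solve 0 (κ 2 :* (κ 1 :* κ 1 :- κ 1) :- κ 2 :* κ 1 := :- κ 2) refl ⟩
      - (1# + 1#) ∎

    U₋₁ : U -[1+ 0 ] ≈ 0#
    U₋₁ = last-term-vanishes (conjugateSum-recurrence a b -[1+ 0 ])
      (trans (+-cong U₁ U₀) (-‿inverseˡ 1#))

    V₋₁ : V -[1+ 0 ] ≈ 0#
    V₋₁ = last-term-vanishes (V-recurrence -[1+ 0 ])
      (trans (+-cong V₁ V₀) (trans (solve 0 (:- κ 2 :+ κ 1 := :- κ 1) refl) (sym U₁)))

    V₋₂ : V -[1+ 1 ] ≈ 0#
    V₋₂ = last-term-vanishes (V-recurrence -[1+ 1 ])
      (trans (+-cong V₀ V₋₁) (trans (+-identityʳ 1#) (sym U₀)))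

    V₋₃ : V -[1+ 2 ] ≈ 0#
    V₋₃ = last-term-vanishes (V-recurrence -[1+ 2 ])
      (trans (+-cong V₋₁ V₋₂) (trans (+-identityʳ 0#) (sym U₋₁)))

    U-vanishes : VanishesDownTo 1 U
    U-vanishes 1 _ _ = U₋₁
    U-vanishes (suc (suc _)) _ (s≤s ())

    V-vanishes : VanishesDownTo 3 V
    V-vanishes 1 _ _ = V₋₁
    V-vanishes 2 _ _ = V₋₂
    V-vanishes 3 _ _ = V₋₃
    V-vanishes (suc (suc (suc (suc _)))) _ (s≤s (s≤s (s≤s ())))

    invQ≈U : ∀ n → invQ R n ≈ U (+ n)
    invQ≈U = recurrence-unique invQ-recurrence (λ n → conjugateSum-recurrence a b (+ n)) (λ _ → refl)
      (sym U₀) (sym U₁)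

    invQ2≈V : ∀ n → invQ2 R n ≈ V (+ n)
    invQ2≈V = recurrence-unique
      (⋆-recurrence (invQ R) (invQ R) invQ-recurrence refl (-‿inverseˡ 1#)) (λ n → V-recurrence (+ n))
      (λ n → invQ≈U (suc (suc n)))
      (trans (*-identityˡ 1#) (sym V₀))
      (trans (solve 0 (κ 1 :* (:- κ 1) :+ (:- κ 1) :* κ 1 := :- κ 2) refl) (sym V₁))

    rhs1-expansion : ∀ p i → rhs1 p i ≈ weightedSum (λ j → U ((j +ℕ i) ⊖ low p)) 0 (cs p)
    rhs1-expansion p i = begin
      (a * evalL R ζ ζ̄ p) * pow R ζ i + (b * evalL R ζ̄ ζ p) * pow R ζ̄ i
        ≈⟨ +-cong (*-assoc _ _ _) (*-assoc _ _ _) ⟩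
      a * (evalL R ζ ζ̄ p * pow R ζ i) + b * (evalL R ζ̄ ζ p * pow R ζ̄ i)
        ≈⟨ +-cong (*-congˡ (Z.evalL-expansion p i)) (*-congˡ (Z̄.evalL-expansion p i)) ⟩
      a * Σ (λ j → Z.zpow (m j)) + b * Σ (λ j → Z̄.zpow (m j))
        ≈⟨ weightedSum-linear a b _ _ 0 (cs p) ⟩
      Σ (λ j → U (m j)) ∎
      where
      Σ : (ℕ → Carrier) → Carrier
      Σ f = weightedSum f 0 (cs p)
      m : ℕ → ℤ
      m j = (j +ℕ i) ⊖ low p

    rhs2-expansion : ∀ p i → rhs2 p i ≈ weightedSum (λ j → V ((j +ℕ i) ⊖ low p)) 0 (cs p)
    rhs2-expansion p i = begin
      twoThirds * rhs1 p i + ((a * a) * Dζ + (b * b) * Dζ̄)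
        ≈⟨ +-cong (*-congˡ (rhs1-expansion p i))
                  (+-cong (*-congˡ (Z.second-order-expansion p i)) (*-congˡ (Z̄.second-order-expansion p i))) ⟩
      twoThirds * Σ (λ j → U (m j))
        + ((a * a) * Σ (λ j → w j * Z.zpow (m j)) + (b * b) * Σ (λ j → w j * Z̄.zpow (m j)))
        ≈⟨ trans (+-cong (weightedSum-*ˡ twoThirds _ 0 (cs p)) (weightedSum-linear (a * a) (b * b) _ _ 0 (cs p)))
                 (weightedSum-+ _ _ 0 (cs p)) ⟩
      Σ (λ j → twoThirds * U (m j) + ((a * a) * (w j * Z.zpow (m j)) + (b * b) * (w j * Z̄.zpow (m j))))
        ≈⟨ weightedSum-cong (λ j → +-congˡ (trans (factor-weight j) (*-congʳ (exponent-weight j i (low p)))))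
                            0 (cs p) ⟩
      Σ (λ j → V (m j)) ∎
      where
      Σ : (ℕ → Carrier) → Carrier
      Σ f = weightedSum f 0 (cs p)
      m : ℕ → ℤ
      m j = (j +ℕ i) ⊖ low p
      w : ℕ → Carrier
      w j = (nat R j - nat R (low p)) + nat R (suc i)
      Dζ Dζ̄ : Carrier
      Dζ = (ζ * evalL R ζ ζ̄ (derivL R p)) * pow R ζ i + evalL R ζ ζ̄ p * _⋆_ R (geom R ζ) (geom R ζ) i
      Dζ̄ = (ζ̄ * evalL R ζ̄ ζ (derivL R p)) * pow R ζ̄ i + evalL R ζ̄ ζ p * _⋆_ R (geom R ζ̄) (geom R ζ̄) i
      factor-weight : ∀ j → (a * a) * (w j * Z.zpow (m j)) + (b * b) * (w j * Z̄.zpow (m j)) ≈ w j * W (m j)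
      factor-weight j = solve 5 (λ A B w x y → A :* (w :* x) :+ B :* (w :* y) := w :* (A :* x :+ B :* y))
        refl (a * a) (b * b) (w j) (Z.zpow (m j)) (Z̄.zpow (m j))

    identity1 : ∀ d → VanishesDownTo d U → Identity1 d
    identity1 d vanish F F∈ k i = trans
      (nonnegCoef-expansion (invQ R) U d invQ≈U vanish (coef F k) (F∈ k) i)
      (sym (rhs1-expansion (coef F k) i))

    identity2 : ∀ d → VanishesDownTo d V → Identity2 d
    identity2 d vanish F F∈ k i = trans
      (nonnegCoef-expansion (invQ2 R) V d invQ2≈V vanish (coef F k) (F∈ k) i)
      (sym (rhs2-expansion (coef F k) i))

lemma6 : {c ℓ : Level} (R : CommutativeRing c ℓ) →
    let open CommutativeRing R in
    (ζ : Carrier) → ζ * ζ + ζ + 1# ≈ 0# →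
    (a : Carrier) → (1# - ζ) * a ≈ 1# →
    (b : Carrier) → (1# - ζ * ζ) * b ≈ 1# →
    (twoThirds : Carrier) → (1# + 1# + 1#) * twoThirds ≈ 1# + 1# →
    let open Identities R ζ (ζ * ζ) a b twoThirds in
    Identity1 0 × Identity2 0 × Identity1 1 × Identity2 3
lemma6 R ζ root a a-inverse b b-inverse twoThirds twoThirds-spec =
  identity1 0 (vanishesDownTo-mono {Φ = U} z≤n U-vanishes) ,
  identity2 0 (vanishesDownTo-mono {Φ = V} z≤n V-vanishes) ,
  identity1 1 U-vanishes ,
  identity2 3 V-vanishes
  where
  open CommutativeRing R using (_*_)
  open LaurentExpansion R using (root-conjugate-sum; root-cube; vanishesDownTo-mono)
  open CubeRoots R ζ (ζ * ζ) (root-conjugate-sum root) (root-cube root)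
    a a-inverse b b-inverse twoThirds twoThirds-spec
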